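{- Let $n\geq3$ be an integer, let $p>3$ be a prime with $p\equiv1\pmod{n}$, and put $m=(p-1)/n$. Then $$ \sum_{k=0}^{p-1}\frac{(1+m)_k^n}{(1)_k^n}\sum_{j=1}^k\frac{1}{j}\equiv\sum_{k=0}^{p-1}\frac{(1+m)_k^n}{(1)_k^n}\sum_{j=1}^{k+m}\frac{1}{j}\pmod{p}, $$ $$ \sum_{k=0}^{p-1}\frac{(1+m)_k^n}{(1)_k^n}\left(\sum_{j=1}^k\frac{1}{j}\right)^2\equiv\sum_{k=0}^{p-1}\frac{(1+m)_k^n}{(1)_k^n}\left(\sum_{j=1}^{k+m}\frac{1}{j}\right)^2\pmod{p}, $$ and $$ \sum_{k=0}^{p-1}\frac{(1+m)_k^n}{(1)_k^n}\sum_{j=1}^k\frac{1}{j^2}\equiv-\sum_{k=0}^{p-1}\frac{(1+m)_k^n}{(1)_k^n}\sum_{j=1}^{k+m}\frac{1}{j^2}\pmod{p}. $$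
   Context: $(x)_k=x(x+1)\cdots(x+k-1)$ for $k\geq1$, $(x)_0=1$; so $(1+m)_k/(1)_k=\binom{m+k}{m}$. All quantities are regarded as elements of $\mathbb Q$ that lie in $\mathbb Z_{p}$ (the $p$-adic integers), and congruences are in $\mathbb Z_p$. -}

module Defs where

open import Data.Nat as ℕ using (ℕ; zero; suc)
open import Data.Nat.Divisibility using (_∣_)
open import Data.Nat.Combinatorics using (_C_)
open import Data.Integer as ℤ using (+_)
open import Data.Rational using (ℚ; 0ℚ; 1ℚ; _+_; _*_; _-_; _/_; ↧ₙ_)
open import Data.Product using (Σ; _×_)
open import Relation.Nullary using (¬_)
open import Relation.Binary.PropositionalEquality using (_≡_)

ι : ℕ → ℚ
ι k = + k / 1

pow : ℚ → ℕ → ℚ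
pow q zero    = 1ℚ
pow q (suc e) = q * pow q e

sumBelow : ℕ → (ℕ → ℚ) → ℚ
sumBelow zero    f = 0ℚ
sumBelow (suc N) f = sumBelow N f + f N

H : ℕ → ℚ
H zero    = 0ℚ
H (suc k) = H k + (+ 1 / suc k)

H2 : ℕ → ℚ
H2 zero    = 0ℚ
H2 (suc k) = H2 k + (+ 1 / (suc k ℕ.* suc k))

pIntegral : ℕ → ℚ → Set
pIntegral p q = ¬ (p ∣ (↧ₙ q))

_≡_[modℚ_] : ℚ → ℚ → ℕ → Set
a ≡ b [modℚ p ] = Σ ℚ (λ z → pIntegral p z × (a - b ≡ ι p * z))

-- (1+m)_k^n / (1)_k^n = binom(m+k, m)^n
coef : ℕ → ℕ → ℕ → ℚ
coef n m k = pow (ι ((m ℕ.+ k) C m)) n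

-- Put N = p - 1 - m = m (n - 1) and B k = C(m + k, m), so the weights are B k ^ n. Modulo p,
-- B N · B k ≡ B (N - k) for k ≤ N (since m + i ≡ -(N + 1 - i)), and B N ^ n ≡ 1 because n or N
-- is even: the weights are symmetric under k ↦ N - k, while for N < k < p they are divisible by
-- p ^ n with n ≥ 3. Pairing 1/j with 1/(p - j) gives H a ≡ H b and H2 a ≡ - H2 b whenever
-- a + b = p - 1 (using H (p - 1) ≡ H2 (p - 1) ≡ 0 for p > 3), and for k < p the numbers H (k + m),
-- H2 (k + m) have at most a simple resp. double pole at p. So reflecting the range k ≤ N turns each
-- right-hand sum into the left-hand one, and the terms N < k < p vanish mod p on both sides.

module Submission where

open import Data.Nat as ℕ using (ℕ; suc; _<_)
open import Data.Nat.Primality using (Prime)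
open import Relation.Binary.PropositionalEquality using (_≡_)

open import Defs

module ℕ-Facts where

  open import Data.Nat using (zero; suc; _+_; _*_; _∸_; _!)
  open import Data.Nat.Properties
  open import Data.Nat.Divisibility using (_∣_; divides; ∣n⇒∣m*n)
  open import Data.Nat.DivMod using (_/_; m/n*n≡m)
  open import Data.Nat.Combinatorics using (_C_; nCk≡n!/k![n-k]!; k![n∸k]!∣n!)
  open import Data.Sum using (_⊎_; inj₁; inj₂)
  open import Relation.Binary.PropositionalEquality
  open import Data.Nat.Tactic.RingSolver using (solve-∀)

  2∣n⊎2∣1+n : ∀ n → 2 ∣ n ⊎ 2 ∣ suc n
  2∣n⊎2∣1+n zero = inj₁ (divides 0 refl)
  2∣n⊎2∣1+n (suc n) with 2∣n⊎2∣1+n n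
  ... | inj₁ (divides q n≡q*2) = inj₂ (divides (suc q) (cong (2 +_) n≡q*2))
  ... | inj₂ 2∣1+n = inj₁ 2∣1+n

  2∣1+n⊎2∣m*n : ∀ m n → 2 ∣ suc n ⊎ 2 ∣ m * n
  2∣1+n⊎2∣m*n m n with 2∣n⊎2∣1+n n
  ... | inj₁ 2∣n = inj₂ (∣n⇒∣m*n m 2∣n)
  ... | inj₂ 2∣1+n = inj₁ 2∣1+n

  m*2≡m+m : ∀ m → m * 2 ≡ m + m
  m*2≡m+m m = trans (*-comm m 2) (cong (m +_) (+-identityʳ m))

  [m+k]Cm*[m!*k!]≡[m+k]! : ∀ m k → ((m + k) C m) * (m ! * k !) ≡ (m + k) !
  [m+k]Cm*[m!*k!]≡[m+k]! m k = begin
    ((m + k) C m) * (m ! * k !)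
      ≡⟨ cong (λ i → ((m + k) C m) * (m ! * i !)) (sym (m+n∸m≡n m k)) ⟩
    ((m + k) C m) * (m ! * (m + k ∸ m) !)
      ≡⟨ cong (_* (m ! * (m + k ∸ m) !)) (nCk≡n!/k![n-k]! (m≤m+n m k)) ⟩
    ((m + k) ! / (m ! * (m + k ∸ m) !)) {{m !* (m + k ∸ m) !≢0}} * (m ! * (m + k ∸ m) !)
      ≡⟨ m/n*n≡m {{m !* (m + k ∸ m) !≢0}} (k![n∸k]!∣n! (m≤m+n m k)) ⟩
    (m + k) ! ∎
    where open ≡-Reasoning

  [1+k]*[m+1+k]Cm≡[m+1+k]*[m+k]Cm : ∀ m k → suc k * ((m + suc k) C m) ≡ (m + suc k) * ((m + k) C m)
  [1+k]*[m+1+k]Cm≡[m+1+k]*[m+k]Cm m k = *-cancelʳ-≡ _ _ (m ! * k !) {{m !* k !≢0}} (begin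
    suc k * ((m + suc k) C m) * (m ! * k !)        ≡⟨ shuffle (suc k) ((m + suc k) C m) (m !) (k !) ⟩
    ((m + suc k) C m) * (m ! * (suc k * k !))      ≡⟨ [m+k]Cm*[m!*k!]≡[m+k]! m (suc k) ⟩
    (m + suc k) !                                  ≡⟨ cong _! (+-suc m k) ⟩
    suc (m + k) * (m + k) !                        ≡⟨ cong₂ _*_ (sym (+-suc m k)) (sym ([m+k]Cm*[m!*k!]≡[m+k]! m k)) ⟩
    (m + suc k) * (((m + k) C m) * (m ! * k !))    ≡⟨ sym (*-assoc (m + suc k) ((m + k) C m) (m ! * k !)) ⟩
    (m + suc k) * ((m + k) C m) * (m ! * k !)      ∎)
    where
    open ≡-Reasoning
    shuffle : ∀ a b c d → a * b * (c * d) ≡ b * (c * (a * d))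
    shuffle = solve-∀

module Embedding where

  open import Data.Nat using (ℕ; suc)
  open import Data.Integer as ℤ using (+_)
  import Data.Integer.Properties as ℤP
  open import Data.Rational using (ℚ; 1ℚ; _+_; _*_; _/_; toℚᵘ)
  import Data.Rational.Properties as ℚP
  open import Data.Rational.Properties using (toℚᵘ-injective; toℚᵘ-fromℚᵘ; toℚᵘ-homo-+; toℚᵘ-homo-*)
  import Data.Rational.Unnormalised as U
  import Data.Rational.Unnormalised.Properties as UP
  open import Relation.Binary.PropositionalEquality
  open import Data.Rational.Solver using (module +-*-Solver)
  open +-*-Solver
  open import Data.List using (_∷_; [])
  import Data.Nat.Tactic.RingSolver as ℕ-RingSolver
  open ℕ-Facts using (m*2≡m+m)

  1/suc : ℕ → ℚ
  1/suc k = + 1 / suc k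

  toℚᵘ-ι : ∀ a → toℚᵘ (ι a) U.≃ U.mkℚᵘ (+ a) 0
  toℚᵘ-ι a = toℚᵘ-fromℚᵘ (U.mkℚᵘ (+ a) 0)

  ι-+ : ∀ a b → ι (a ℕ.+ b) ≡ ι a + ι b
  ι-+ a b = toℚᵘ-injective (begin
    toℚᵘ (ι (a ℕ.+ b))                 ≈⟨ toℚᵘ-ι (a ℕ.+ b) ⟩
    U.mkℚᵘ (+ (a ℕ.+ b)) 0             ≈⟨ U.*≡* ints ⟩
    U.mkℚᵘ (+ a) 0 U.+ U.mkℚᵘ (+ b) 0  ≈⟨ UP.≃-sym (UP.+-cong (toℚᵘ-ι a) (toℚᵘ-ι b)) ⟩
    toℚᵘ (ι a) U.+ toℚᵘ (ι b)          ≈⟨ UP.≃-sym (toℚᵘ-homo-+ (ι a) (ι b)) ⟩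
    toℚᵘ (ι a + ι b)                   ∎)
    where
    open UP.≃-Reasoning
    ints : + (a ℕ.+ b) ℤ.* + 1 ≡ (+ a ℤ.* + 1 ℤ.+ + b ℤ.* + 1) ℤ.* + 1
    ints rewrite ℤP.*-identityʳ (+ (a ℕ.+ b)) | ℤP.*-identityʳ (+ a) | ℤP.*-identityʳ (+ b)
               | ℤP.*-identityʳ (+ a ℤ.+ + b) = ℤP.pos-+ a b

  ι-* : ∀ a b → ι (a ℕ.* b) ≡ ι a * ι b
  ι-* a b = toℚᵘ-injective (begin
    toℚᵘ (ι (a ℕ.* b))                 ≈⟨ toℚᵘ-ι (a ℕ.* b) ⟩
    U.mkℚᵘ (+ (a ℕ.* b)) 0             ≈⟨ U.*≡* (cong (ℤ._* + 1) (ℤP.pos-* a b)) ⟩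
    U.mkℚᵘ (+ a) 0 U.* U.mkℚᵘ (+ b) 0  ≈⟨ UP.≃-sym (UP.*-cong (toℚᵘ-ι a) (toℚᵘ-ι b)) ⟩
    toℚᵘ (ι a) U.* toℚᵘ (ι b)          ≈⟨ UP.≃-sym (toℚᵘ-homo-* (ι a) (ι b)) ⟩
    toℚᵘ (ι a * ι b)                   ∎)
    where open UP.≃-Reasoning

  ι[1+k]*1/suc≡1 : ∀ k → ι (suc k) * 1/suc k ≡ 1ℚ
  ι[1+k]*1/suc≡1 k = toℚᵘ-injective (begin
    toℚᵘ (ι (suc k) * 1/suc k)              ≈⟨ toℚᵘ-homo-* (ι (suc k)) (1/suc k) ⟩
    toℚᵘ (ι (suc k)) U.* toℚᵘ (1/suc k)     ≈⟨ UP.*-cong (toℚᵘ-ι (suc k)) (toℚᵘ-fromℚᵘ (U.mkℚᵘ (+ 1) k)) ⟩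
    U.mkℚᵘ (+ suc k) 0 U.* U.mkℚᵘ (+ 1) k   ≈⟨ U.*≡* (cong (λ i → + suc i) (ℕ-RingSolver.solve (k ∷ []))) ⟩
    U.mkℚᵘ (+ 1) 0                          ≈⟨ UP.≃-sym (toℚᵘ-fromℚᵘ (U.mkℚᵘ (+ 1) 0)) ⟩
    toℚᵘ 1ℚ                                 ∎)
    where open UP.≃-Reasoning

  1/suc-unique : ∀ k {q} → ι (suc k) * q ≡ 1ℚ → q ≡ 1/suc k
  1/suc-unique k {q} ι[1+k]*q≡1 = begin
    q                             ≡⟨ sym (ℚP.*-identityˡ q) ⟩
    1ℚ * q                        ≡⟨ cong (_* q) (sym (trans (ℚP.*-comm (1/suc k) (ι (suc k))) (ι[1+k]*1/suc≡1 k))) ⟩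
    1/suc k * ι (suc k) * q       ≡⟨ ℚP.*-assoc (1/suc k) (ι (suc k)) q ⟩
    1/suc k * (ι (suc k) * q)     ≡⟨ cong (1/suc k *_) ι[1+k]*q≡1 ⟩
    1/suc k * 1ℚ                  ≡⟨ ℚP.*-identityʳ (1/suc k) ⟩
    1/suc k                       ∎
    where open ≡-Reasoning

  1/[suc*suc]≡1/suc*1/suc : ∀ k → + 1 / (suc k ℕ.* suc k) ≡ 1/suc k * 1/suc k
  1/[suc*suc]≡1/suc*1/suc k = sym (1/suc-unique (k ℕ.+ k ℕ.* suc k) (begin
    ι (suc k ℕ.* suc k) * (1/suc k * 1/suc k)        ≡⟨ cong (_* (1/suc k * 1/suc k)) (ι-* (suc k) (suc k)) ⟩
    ι (suc k) * ι (suc k) * (1/suc k * 1/suc k)      ≡⟨ solve 2 (λ x u → x :* x :* (u :* u) := (x :* u) :* (x :* u)) refl (ι (suc k)) (1/suc k) ⟩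
    (ι (suc k) * 1/suc k) * (ι (suc k) * 1/suc k)    ≡⟨ cong₂ _*_ (ι[1+k]*1/suc≡1 k) (ι[1+k]*1/suc≡1 k) ⟩
    1ℚ * 1ℚ                                          ≡⟨⟩
    1ℚ                                               ∎))
    where open ≡-Reasoning

  ι2*1/suc[1+i+i]≡1/suc : ∀ i → ι 2 * 1/suc (suc (i ℕ.+ i)) ≡ 1/suc i
  ι2*1/suc[1+i+i]≡1/suc i = 1/suc-unique i (begin
    ι (suc i) * (ι 2 * 1/suc (suc (i ℕ.+ i)))    ≡⟨ sym (ℚP.*-assoc (ι (suc i)) (ι 2) _) ⟩
    ι (suc i) * ι 2 * 1/suc (suc (i ℕ.+ i))      ≡⟨ cong (_* 1/suc (suc (i ℕ.+ i))) (sym (ι-* (suc i) 2)) ⟩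
    ι (suc i ℕ.* 2) * 1/suc (suc (i ℕ.+ i))      ≡⟨ cong (λ j → ι (suc (suc j)) * 1/suc (suc (i ℕ.+ i))) (m*2≡m+m i) ⟩
    ι (suc (suc (i ℕ.+ i))) * 1/suc (suc (i ℕ.+ i)) ≡⟨ ι[1+k]*1/suc≡1 (suc (i ℕ.+ i)) ⟩
    1ℚ                                           ∎)
    where open ≡-Reasoning

module FiniteSums where

  open import Data.Nat using (ℕ; zero; suc; _∸_)
  import Data.Nat.Properties as ℕP
  open import Data.Rational using (ℚ; 0ℚ; _+_; _*_; -_)
  import Data.Rational.Properties as ℚP
  open import Relation.Binary.PropositionalEquality
  open import Data.Rational.Solver using (module +-*-Solver)
  open +-*-Solver

  sumBelow-cong : ∀ N {f g} → (∀ k → k ℕ.< N → f k ≡ g k) → sumBelow N f ≡ sumBelow N g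
  sumBelow-cong zero     f≡g = refl
  sumBelow-cong (suc N)  f≡g = cong₂ _+_ (sumBelow-cong N (λ k k<N → f≡g k (ℕP.m<n⇒m<1+n k<N))) (f≡g N ℕP.≤-refl)

  sumBelow-+ : ∀ a b f → sumBelow (a ℕ.+ b) f ≡ sumBelow a f + sumBelow b (λ k → f (a ℕ.+ k))
  sumBelow-+ a zero    f = trans (cong (λ i → sumBelow i f) (ℕP.+-identityʳ a)) (sym (ℚP.+-identityʳ _))
  sumBelow-+ a (suc b) f = begin
    sumBelow (a ℕ.+ suc b) f                                    ≡⟨ cong (λ i → sumBelow i f) (ℕP.+-suc a b) ⟩
    sumBelow (a ℕ.+ b) f + f (a ℕ.+ b)                          ≡⟨ cong (_+ f (a ℕ.+ b)) (sumBelow-+ a b f) ⟩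
    sumBelow a f + sumBelow b (λ k → f (a ℕ.+ k)) + f (a ℕ.+ b) ≡⟨ ℚP.+-assoc (sumBelow a f) _ (f (a ℕ.+ b)) ⟩
    sumBelow a f + sumBelow (suc b) (λ k → f (a ℕ.+ k))         ∎
    where open ≡-Reasoning

  sumBelow-suc : ∀ N f → sumBelow (suc N) f ≡ f 0 + sumBelow N (λ k → f (suc k))
  sumBelow-suc N f = trans (sumBelow-+ 1 N f) (cong (_+ sumBelow N (λ k → f (suc k))) (ℚP.+-identityˡ (f 0)))

  sumBelow-reverse : ∀ N f → sumBelow N (λ k → f (N ∸ suc k)) ≡ sumBelow N f
  sumBelow-reverse zero    f = refl
  sumBelow-reverse (suc N) f = begin
    sumBelow N (λ k → f (N ∸ k)) + f (N ∸ N)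
      ≡⟨ cong₂ _+_ (sumBelow-cong N (λ k k<N → cong f (ℕP.+-∸-assoc 1 k<N))) (cong f (ℕP.n∸n≡0 N)) ⟩
    sumBelow N (λ k → f (suc (N ∸ suc k))) + f 0      ≡⟨ cong (_+ f 0) (sumBelow-reverse N (λ k → f (suc k))) ⟩
    sumBelow N (λ k → f (suc k)) + f 0                ≡⟨ ℚP.+-comm _ (f 0) ⟩
    f 0 + sumBelow N (λ k → f (suc k))                ≡⟨ sym (sumBelow-suc N f) ⟩
    sumBelow (suc N) f                                ∎
    where open ≡-Reasoning

  sumBelow-even+odd : ∀ h f → sumBelow (h ℕ.+ h) f ≡ sumBelow h (λ i → f (i ℕ.+ i)) + sumBelow h (λ i → f (suc (i ℕ.+ i)))
  sumBelow-even+odd zero    f = refl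
  sumBelow-even+odd (suc h) f = begin
    sumBelow (suc h ℕ.+ suc h) f                          ≡⟨ cong (λ i → sumBelow (suc i) f) (ℕP.+-suc h h) ⟩
    sumBelow (h ℕ.+ h) f + f (h ℕ.+ h) + f (suc (h ℕ.+ h)) ≡⟨ cong (λ s → s + f (h ℕ.+ h) + f (suc (h ℕ.+ h))) (sumBelow-even+odd h f) ⟩
    E + O + f (h ℕ.+ h) + f (suc (h ℕ.+ h))               ≡⟨ solve 4 (λ e o x y → e :+ o :+ x :+ y := (e :+ x) :+ (o :+ y)) refl E O _ _ ⟩
    (E + f (h ℕ.+ h)) + (O + f (suc (h ℕ.+ h)))           ∎
    where
    open ≡-Reasoning
    E O : ℚ
    E = sumBelow h (λ i → f (i ℕ.+ i))
    O = sumBelow h (λ i → f (suc (i ℕ.+ i)))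

  neg-sumBelow : ∀ N f → - sumBelow N f ≡ sumBelow N (λ k → - f k)
  neg-sumBelow zero    f = refl
  neg-sumBelow (suc N) f = trans (ℚP.neg-distrib-+ (sumBelow N f) (f N)) (cong (_+ - f N) (neg-sumBelow N f))

  sumBelow-*-negate : ∀ N (c f : ℕ → ℚ) → sumBelow N (λ k → c k * f k) ≡ - sumBelow N (λ k → c k * - f k)
  sumBelow-*-negate N c f = begin
    sumBelow N (λ k → c k * f k)          ≡⟨ solve 1 (λ s → s := :- (:- s)) refl (sumBelow N (λ k → c k * f k)) ⟩
    - (- sumBelow N (λ k → c k * f k))    ≡⟨ cong -_ (neg-sumBelow N (λ k → c k * f k)) ⟩
    - sumBelow N (λ k → - (c k * f k))    ≡⟨ cong -_ (sumBelow-cong N (λ k _ → ℚP.neg-distribʳ-* (c k) (f k))) ⟩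
    - sumBelow N (λ k → c k * - f k)      ∎
    where open ≡-Reasoning

  *-sumBelow : ∀ c N f → c * sumBelow N f ≡ sumBelow N (λ k → c * f k)
  *-sumBelow c zero    f = ℚP.*-zeroʳ c
  *-sumBelow c (suc N) f = trans (ℚP.*-distribˡ-+ c (sumBelow N f) (f N)) (cong (_+ c * f N) (*-sumBelow c N f))

  sumBelow-0 : ∀ N → sumBelow N (λ _ → 0ℚ) ≡ 0ℚ
  sumBelow-0 zero    = refl
  sumBelow-0 (suc N) = cong (_+ 0ℚ) (sumBelow-0 N)

module Powers where

  open import Data.Nat using (ℕ; zero; suc)
  open import Data.Rational using (1ℚ; _*_)
  import Data.Rational.Properties as ℚP
  open import Relation.Binary.PropositionalEquality
  open import Data.Rational.Solver using (module +-*-Solver)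
  open +-*-Solver

  pow-distribʳ-* : ∀ a b e → pow (a * b) e ≡ pow a e * pow b e
  pow-distribʳ-* a b zero    = refl
  pow-distribʳ-* a b (suc e) = trans (cong ((a * b) *_) (pow-distribʳ-* a b e))
    (solve 4 (λ a b x y → (a :* b) :* (x :* y) := (a :* x) :* (b :* y)) refl a b (pow a e) (pow b e))

  pow-distribˡ-+-* : ∀ a d e → pow a (d ℕ.+ e) ≡ pow a d * pow a e
  pow-distribˡ-+-* a zero    e = sym (ℚP.*-identityˡ (pow a e))
  pow-distribˡ-+-* a (suc d) e = trans (cong (a *_) (pow-distribˡ-+-* a d e)) (sym (ℚP.*-assoc a (pow a d) (pow a e)))

  pow-*-pow : ∀ a d e → pow a (e ℕ.* d) ≡ pow (pow a d) e
  pow-*-pow a d zero    = refl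
  pow-*-pow a d (suc e) = trans (pow-distribˡ-+-* a d (e ℕ.* d)) (cong (pow a d *_) (pow-*-pow a d e))

  pow-1ℚ : ∀ e → pow 1ℚ e ≡ 1ℚ
  pow-1ℚ zero    = refl
  pow-1ℚ (suc e) = trans (cong (1ℚ *_) (pow-1ℚ e)) (ℚP.*-identityˡ 1ℚ)

module Congruence (p : ℕ) (p-prime : Prime p) where

  open import Data.Nat using (ℕ; zero; suc; _∸_)
  import Data.Nat.Properties as ℕP
  open import Data.Nat.Divisibility using (_∣_; divides; ∣-trans; >⇒∤; _∣0)
  open import Data.Nat.Primality using (euclidsLemma; prime⇒nonTrivial)
  open import Data.Integer as ℤ using (ℤ; +_)
  import Data.Integer.Properties as ℤP
  open import Data.Rational using (ℚ; 0ℚ; 1ℚ; _+_; _*_; _-_; -_; _/_; ↧_)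
  import Data.Rational.Properties as ℚP
  open import Data.Product using (_,_)
  open import Data.Sum using (inj₁; inj₂)
  open import Data.Empty using (⊥-elim)
  open import Relation.Nullary using (¬_)
  open import Relation.Binary.Bundles using (Setoid)
  import Relation.Binary.Reasoning.Setoid as SetoidReasoning
  open import Relation.Binary.PropositionalEquality
  open import Data.Rational.Solver using (module +-*-Solver)
  open +-*-Solver
  open Embedding
  open FiniteSums

  -- Records instead of the Σ-types of Defs, so that the rationals involved stay inferable.
  record Integral (q : ℚ) : Set where
    constructor integral
    field p∤denominator : pIntegral p q

  infix 4 _≈_
  record _≈_ (a b : ℚ) : Set where
    constructor ≈-by
    field
      quotient          : ℚ
      quotient-integral : Integral quotient
      difference        : a - b ≡ ι p * quotient

  ≈⇒≡[modℚ] : ∀ {a b} → a ≈ b → a ≡ b [modℚ p ]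
  ≈⇒≡[modℚ] (≈-by z (integral z∈ℤₚ) a-b≡pz) = z , z∈ℤₚ , a-b≡pz

  p∤suc : ∀ {k} → suc k ℕ.< p → ¬ p ∣ suc k
  p∤suc = >⇒∤

  p∤1 : ¬ p ∣ 1
  p∤1 = p∤suc (ℕ.nonTrivial⇒n>1 p {{prime⇒nonTrivial p-prime}})

  p∤* : ∀ {a b} → ¬ p ∣ a → ¬ p ∣ b → ¬ p ∣ a ℕ.* b
  p∤* {a} {b} p∤a p∤b p∣ab with euclidsLemma a b p-prime p∣ab
  ... | inj₁ p∣a = p∤a p∣a
  ... | inj₂ p∣b = p∤b p∣b

  private
    ∣x∣∣∣x*y∣ : ∀ (x : ℤ) {y z : ℤ} → x ℤ.* y ≡ z → ℤ.∣ x ∣ ∣ ℤ.∣ z ∣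
    ∣x∣∣∣x*y∣ x {y} refl = divides ℤ.∣ y ∣ (trans (ℤP.abs-* x y) (ℕP.*-comm ℤ.∣ x ∣ ℤ.∣ y ∣))

  integral-* : ∀ {a b} → Integral a → Integral b → Integral (a * b)
  integral-* {a} {b} (integral p∤a) (integral p∤b) =
    integral λ p∣ab → p∤* p∤a p∤b (∣-trans p∣ab (∣x∣∣∣x*y∣ (↧ (a * b)) (ℚP.↧-* a b)))

  integral-+ : ∀ {a b} → Integral a → Integral b → Integral (a + b)
  integral-+ {a} {b} (integral p∤a) (integral p∤b) =
    integral λ p∣a+b → p∤* p∤a p∤b (∣-trans p∣a+b (∣x∣∣∣x*y∣ (↧ (a + b)) (ℚP.↧-+ a b)))

  integral-neg : ∀ {a} → Integral a → Integral (- a)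
  integral-neg {a} (integral p∤a) = integral λ p∣-a → p∤a (subst (p ∣_) (cong ℤ.∣_∣ (ℚP.↧-neg a)) p∣-a)

  integral-/ : ∀ i k → ¬ p ∣ suc k → Integral (i / suc k)
  integral-/ i k p∤1+k = integral λ p∣ → p∤1+k (∣-trans p∣ (∣x∣∣∣x*y∣ (↧ (i / suc k)) (ℚP.↧-/ i (suc k))))

  integral-1/suc : ∀ {k} → ¬ p ∣ suc k → Integral (1/suc k)
  integral-1/suc {k} = integral-/ (+ 1) k

  integral-ι : ∀ k → Integral (ι k)
  integral-ι k = integral-/ (+ k) 0 p∤1

  integral-pow : ∀ {a} e → Integral a → Integral (pow a e)
  integral-pow zero    _  = integral-ι 1
  integral-pow (suc e) ia = integral-* ia (integral-pow e ia)

  ≈-reflexive : ∀ {a b} → a ≡ b → a ≈ b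
  ≈-reflexive {a} refl = ≈-by 0ℚ (integral-ι 0) (solve 2 (λ a p → a :- a := p :* con 0ℚ) refl a (ι p))

  ≈-refl : ∀ {a} → a ≈ a
  ≈-refl = ≈-reflexive refl

  ≈-sym : ∀ {a b} → a ≈ b → b ≈ a
  ≈-sym {a} {b} (≈-by z iz a-b≡pz) = ≈-by (- z) (integral-neg iz) (begin
    b - a        ≡⟨ solve 2 (λ a b → b :- a := :- (a :- b)) refl a b ⟩
    - (a - b)    ≡⟨ cong -_ a-b≡pz ⟩
    - (ι p * z)  ≡⟨ ℚP.neg-distribʳ-* (ι p) z ⟩
    ι p * - z    ∎)
    where open ≡-Reasoning

  ≈-trans : ∀ {a b c} → a ≈ b → b ≈ c → a ≈ c
  ≈-trans {a} {b} {c} (≈-by z iz a-b≡pz) (≈-by w iw b-c≡pw) = ≈-by (z + w) (integral-+ iz iw) (begin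
    a - c                  ≡⟨ solve 3 (λ a b c → a :- c := (a :- b) :+ (b :- c)) refl a b c ⟩
    (a - b) + (b - c)      ≡⟨ cong₂ _+_ a-b≡pz b-c≡pw ⟩
    ι p * z + ι p * w      ≡⟨ sym (ℚP.*-distribˡ-+ (ι p) z w) ⟩
    ι p * (z + w)          ∎)
    where open ≡-Reasoning

  ≈-setoid : Setoid _ _
  ≈-setoid = record { Carrier = ℚ ; _≈_ = _≈_ ; isEquivalence = record { refl = ≈-refl ; sym = ≈-sym ; trans = ≈-trans } }

  module ≈-Reasoning = SetoidReasoning ≈-setoid

  +-cong : ∀ {a b c d} → a ≈ b → c ≈ d → a + c ≈ b + d
  +-cong {a} {b} {c} {d} (≈-by z iz a-b≡pz) (≈-by w iw c-d≡pw) = ≈-by (z + w) (integral-+ iz iw) (begin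
    (a + c) - (b + d)      ≡⟨ solve 4 (λ a b c d → (a :+ c) :- (b :+ d) := (a :- b) :+ (c :- d)) refl a b c d ⟩
    (a - b) + (c - d)      ≡⟨ cong₂ _+_ a-b≡pz c-d≡pw ⟩
    ι p * z + ι p * w      ≡⟨ sym (ℚP.*-distribˡ-+ (ι p) z w) ⟩
    ι p * (z + w)          ∎)
    where open ≡-Reasoning

  neg-cong : ∀ {a b} → a ≈ b → - a ≈ - b
  neg-cong {a} {b} (≈-by z iz a-b≡pz) = ≈-by (- z) (integral-neg iz) (begin
    - a - - b    ≡⟨ solve 2 (λ a b → :- a :- :- b := :- (a :- b)) refl a b ⟩
    - (a - b)    ≡⟨ cong -_ a-b≡pz ⟩
    - (ι p * z)  ≡⟨ ℚP.neg-distribʳ-* (ι p) z ⟩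
    ι p * - z    ∎)
    where open ≡-Reasoning

  -- a c - b d = a (c - d) + (a - b) d, so the outer factors a, d must be integral.
  *-cong : ∀ {a b c d} → Integral a → Integral d → a ≈ b → c ≈ d → a * c ≈ b * d
  *-cong {a} {b} {c} {d} ia id (≈-by z iz a-b≡pz) (≈-by w iw c-d≡pw) =
    ≈-by (a * w + z * d) (integral-+ (integral-* ia iw) (integral-* iz id)) (begin
      a * c - b * d                      ≡⟨ solve 4 (λ a b c d → a :* c :- b :* d := a :* (c :- d) :+ (a :- b) :* d) refl a b c d ⟩
      a * (c - d) + (a - b) * d          ≡⟨ cong₂ (λ u v → a * u + v * d) c-d≡pw a-b≡pz ⟩
      a * (ι p * w) + (ι p * z) * d      ≡⟨ solve 5 (λ p a w z d → a :* (p :* w) :+ (p :* z) :* d := p :* (a :* w :+ z :* d)) refl (ι p) a w z d ⟩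
      ι p * (a * w + z * d)              ∎)
    where open ≡-Reasoning

  pow-cong : ∀ {a b} e → Integral a → Integral b → a ≈ b → pow a e ≈ pow b e
  pow-cong zero    _  _  _   = ≈-refl
  pow-cong (suc e) ia ib a≈b = *-cong ia (integral-pow e ib) a≈b (pow-cong e ia ib a≈b)

  p*≈0 : ∀ {z} → Integral z → ι p * z ≈ 0ℚ
  p*≈0 {z} iz = ≈-by z iz (ℚP.+-identityʳ (ι p * z))

  ι[p]≈0 : ι p ≈ 0ℚ
  ι[p]≈0 = ≈-trans (≈-reflexive (sym (ℚP.*-identityʳ (ι p)))) (p*≈0 (integral-ι 1))

  +≈0⇒≈- : ∀ {a b} → a + b ≈ 0ℚ → a ≈ - b
  +≈0⇒≈- {a} {b} (≈-by z iz a+b≡pz) = ≈-by z iz (trans (solve 2 (λ a b → a :- :- b := (a :+ b) :- con 0ℚ) refl a b) a+b≡pz)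

  *-cancelˡ-≈ : ∀ {c a b} → ¬ p ∣ c → ι c * a ≈ ι c * b → a ≈ b
  *-cancelˡ-≈ {zero}  p∤0 _ = ⊥-elim (p∤0 (p ∣0))
  *-cancelˡ-≈ {suc c} {a} {b} p∤c (≈-by z iz ca-cb≡pz) = ≈-by (1/suc c * z) (integral-* (integral-1/suc p∤c) iz) (begin
    a - b                                   ≡⟨ sym (ℚP.*-identityˡ (a - b)) ⟩
    1ℚ * (a - b)                            ≡⟨ cong (_* (a - b)) (sym 1/c*c≡1) ⟩
    1/suc c * ι (suc c) * (a - b)           ≡⟨ solve 4 (λ a b c r → r :* c :* (a :- b) := r :* (c :* a :- c :* b)) refl a b (ι (suc c)) (1/suc c) ⟩
    1/suc c * (ι (suc c) * a - ι (suc c) * b) ≡⟨ cong (1/suc c *_) ca-cb≡pz ⟩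
    1/suc c * (ι p * z)                     ≡⟨ solve 3 (λ r p z → r :* (p :* z) := p :* (r :* z)) refl (1/suc c) (ι p) z ⟩
    ι p * (1/suc c * z)                     ∎)
    where
    open ≡-Reasoning
    1/c*c≡1 : 1/suc c * ι (suc c) ≡ 1ℚ
    1/c*c≡1 = trans (ℚP.*-comm (1/suc c) (ι (suc c))) (ι[1+k]*1/suc≡1 c)

  sumBelow-cong-≈ : ∀ N {f g} → (∀ k → k ℕ.< N → f k ≈ g k) → sumBelow N f ≈ sumBelow N g
  sumBelow-cong-≈ zero    f≈g = ≈-refl
  sumBelow-cong-≈ (suc N) f≈g = +-cong (sumBelow-cong-≈ N (λ k k<N → f≈g k (ℕP.m<n⇒m<1+n k<N))) (f≈g N ℕP.≤-refl)

  sumBelow-≈0 : ∀ N {f} → (∀ k → k ℕ.< N → f k ≈ 0ℚ) → sumBelow N f ≈ 0ℚ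
  sumBelow-≈0 N f≈0 = ≈-trans (sumBelow-cong-≈ N f≈0) (≈-reflexive (sumBelow-0 N))

  sumBelow-reflect-≈ : ∀ N M {f g} → (∀ k j → k ℕ.+ j ≡ N → g k ≈ f j) →
    (∀ i → i ℕ.< M → f (suc N ℕ.+ i) ≈ 0ℚ) → (∀ i → i ℕ.< M → g (suc N ℕ.+ i) ≈ 0ℚ) →
    sumBelow (suc N ℕ.+ M) f ≈ sumBelow (suc N ℕ.+ M) g
  sumBelow-reflect-≈ N M {f} {g} g≈f-reflected f-tail≈0 g-tail≈0 = begin
    sumBelow (suc N ℕ.+ M) f                            ≡⟨ sumBelow-+ (suc N) M f ⟩
    sumBelow (suc N) f + sumBelow M (λ i → f (suc N ℕ.+ i)) ≈⟨ +-cong head (sumBelow-≈0 M f-tail≈0) ⟩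
    sumBelow (suc N) g + 0ℚ                             ≈⟨ +-cong (≈-refl {sumBelow (suc N) g}) (≈-sym (sumBelow-≈0 M g-tail≈0)) ⟩
    sumBelow (suc N) g + sumBelow M (λ i → g (suc N ℕ.+ i)) ≡⟨ sym (sumBelow-+ (suc N) M g) ⟩
    sumBelow (suc N ℕ.+ M) g                            ∎
    where
    open ≈-Reasoning
    head : sumBelow (suc N) f ≈ sumBelow (suc N) g
    head = ≈-sym (≈-trans
      (sumBelow-cong-≈ (suc N) (λ k k≤N → g≈f-reflected k (N ∸ k) (ℕP.m+[n∸m]≡n (ℕP.≤-pred k≤N))))
      (≈-reflexive (sumBelow-reverse (suc N) f)))

module HarmonicReflection (p : ℕ) (p-prime : Prime p) (3<p : 3 < p) {T : ℕ} (1+T≡p : suc T ≡ p) where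

  open import Data.Nat using (suc; zero; _∸_; z≤n; s≤s)
  import Data.Nat.Properties as ℕP
  open import Data.Nat.Divisibility using (_∣_; divides)
  open import Data.Nat.Primality using (prime⇒irreducible)
  open import Data.Rational using (ℚ; 0ℚ; 1ℚ; _+_; _*_; _-_; -_)
  import Data.Rational.Properties as ℚP
  open import Data.Product using (∃; _,_)
  open import Data.Sum using (inj₁; inj₂)
  open import Data.Empty using (⊥-elim)
  open import Relation.Nullary using (¬_; yes; no)
  open import Relation.Binary.PropositionalEquality
  open import Data.Rational.Solver using (module +-*-Solver)
  open +-*-Solver
  open import Data.Nat.Tactic.RingSolver using (solve-∀)
  open ℕ-Facts
  open Embedding
  open FiniteSums
  open Congruence p p-prime

  p∤suc-summand : ∀ {a b} → suc a ℕ.+ suc b ≡ p → ¬ p ∣ suc a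
  p∤suc-summand {a} {b} a+b≡p = p∤suc (ℕP.<-≤-trans (ℕP.m<m+n (suc a) (s≤s z≤n)) (ℕP.≤-reflexive a+b≡p))

  1/suc+1/suc≈0 : ∀ a b → suc a ℕ.+ suc b ≡ p → 1/suc a + 1/suc b ≈ 0ℚ
  1/suc+1/suc≈0 a b a+b≡p = ≈-trans (≈-reflexive u+v≡p*uv) (p*≈0 (integral-* (integral-1/suc p∤1+a) (integral-1/suc p∤1+b)))
    where
    open ≡-Reasoning
    x y u v : ℚ
    x = ι (suc a); y = ι (suc b); u = 1/suc a; v = 1/suc b
    p∤1+a : ¬ p ∣ suc a
    p∤1+a = p∤suc-summand a+b≡p
    p∤1+b : ¬ p ∣ suc b
    p∤1+b = p∤suc-summand (trans (ℕP.+-comm (suc b) (suc a)) a+b≡p)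
    u+v≡p*uv : u + v ≡ ι p * (u * v)
    u+v≡p*uv = begin
      u + v                     ≡⟨ cong₂ _+_ (sym (ℚP.*-identityʳ u)) (sym (ℚP.*-identityʳ v)) ⟩
      u * 1ℚ + v * 1ℚ           ≡⟨ cong₂ (λ s t → u * s + v * t) (sym (ι[1+k]*1/suc≡1 b)) (sym (ι[1+k]*1/suc≡1 a)) ⟩
      u * (y * v) + v * (x * u) ≡⟨ solve 4 (λ x y u v → u :* (y :* v) :+ v :* (x :* u) := (x :+ y) :* (u :* v)) refl x y u v ⟩
      (x + y) * (u * v)         ≡⟨ cong (_* (u * v)) (trans (sym (ι-+ (suc a) (suc b))) (cong ι a+b≡p)) ⟩
      ι p * (u * v)             ∎

  1/suc²≈1/suc² : ∀ a b → suc a ℕ.+ suc b ≡ p → 1/suc a * 1/suc a ≈ 1/suc b * 1/suc b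
  1/suc²≈1/suc² a b a+b≡p = ≈-trans (*-cong iu (integral-neg iv) u≈-v u≈-v) (≈-reflexive (solve 1 (λ v → :- v :* :- v := v :* v) refl (1/suc b)))
    where
    iu : Integral (1/suc a)
    iu = integral-1/suc (p∤suc-summand a+b≡p)
    iv : Integral (1/suc b)
    iv = integral-1/suc (p∤suc-summand (trans (ℕP.+-comm (suc b) (suc a)) a+b≡p))
    u≈-v : 1/suc a ≈ - 1/suc b
    u≈-v = +≈0⇒≈- (1/suc+1/suc≈0 a b a+b≡p)

  private
    1+a+1+b≡p : ∀ {a b} → suc a ℕ.+ b ≡ T → suc a ℕ.+ suc b ≡ p
    1+a+1+b≡p {a} {b} a+b≡T = trans (ℕP.+-suc (suc a) b) (trans (cong suc a+b≡T) 1+T≡p)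

  H-difference : ∀ a b → a ℕ.+ b ≡ T → H a - H b ≈ - H T
  H-difference zero    b refl  = ≈-reflexive (ℚP.+-identityˡ (- H b))
  H-difference (suc a) b a+b≡T = begin
    H (suc a) - H b
      ≡⟨ solve 4 (λ ha hb ra rb → (ha :+ ra) :- hb := (ha :- (hb :+ rb)) :+ (ra :+ rb)) refl (H a) (H b) (1/suc a) (1/suc b) ⟩
    (H a - H (suc b)) + (1/suc a + 1/suc b)
      ≈⟨ +-cong (H-difference a (suc b) (trans (ℕP.+-suc a b) a+b≡T)) (1/suc+1/suc≈0 a b (1+a+1+b≡p a+b≡T)) ⟩
    - H T + 0ℚ                                 ≡⟨ ℚP.+-identityʳ (- H T) ⟩
    - H T                                      ∎
    where open ≈-Reasoning

  p∤2 : ¬ p ∣ 2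
  p∤2 = p∤suc (ℕP.<-trans (ℕP.n<1+n 2) 3<p)

  p∤6 : ¬ p ∣ 6
  p∤6 = p∤* {2} {3} p∤2 (p∤suc 3<p)

  H[T]≈0 : H T ≈ 0ℚ
  H[T]≈0 = *-cancelˡ-≈ {2} p∤2 (begin
    ι 2 * H T       ≡⟨ solve 1 (λ h → con (ι 2) :* h := h :+ h) refl (H T) ⟩
    H T + H T       ≈⟨ +-cong (≈-refl {H T}) (≈-trans (≈-reflexive (sym (ℚP.+-identityʳ (H T)))) (H-difference T 0 (ℕP.+-identityʳ T))) ⟩
    H T + - H T     ≡⟨ solve 1 (λ h → h :- h := con (ι 2) :* con 0ℚ) refl (H T) ⟩
    ι 2 * 0ℚ        ∎)
    where open ≈-Reasoning

  H-reflect : ∀ a b → a ℕ.+ b ≡ T → H a ≈ H b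
  H-reflect a b a+b≡T = begin
    H a                ≡⟨ solve 2 (λ x y → x := (x :- y) :+ y) refl (H a) (H b) ⟩
    (H a - H b) + H b  ≈⟨ +-cong (≈-trans (H-difference a b a+b≡T) (neg-cong H[T]≈0)) (≈-refl {H b}) ⟩
    - 0ℚ + H b         ≡⟨ ℚP.+-identityˡ (H b) ⟩
    H b                ∎
    where open ≈-Reasoning

  H2-suc : ∀ k → H2 (suc k) ≡ H2 k + 1/suc k * 1/suc k
  H2-suc k = cong (H2 k +_) (1/[suc*suc]≡1/suc*1/suc k)

  H2-sum : ∀ a b → a ℕ.+ b ≡ T → H2 a + H2 b ≈ H2 T
  H2-sum zero    b refl  = ≈-reflexive (ℚP.+-identityˡ (H2 b))
  H2-sum (suc a) b a+b≡T = begin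
    H2 (suc a) + H2 b                      ≡⟨ cong (_+ H2 b) (H2-suc a) ⟩
    H2 a + 1/suc a * 1/suc a + H2 b        ≡⟨ solve 3 (λ x y u → x :+ u :+ y := (x :+ y) :+ u) refl (H2 a) (H2 b) _ ⟩
    (H2 a + H2 b) + 1/suc a * 1/suc a      ≈⟨ +-cong (≈-refl {H2 a + H2 b}) (1/suc²≈1/suc² a b (1+a+1+b≡p a+b≡T)) ⟩
    (H2 a + H2 b) + 1/suc b * 1/suc b      ≡⟨ trans (ℚP.+-assoc (H2 a) (H2 b) _) (cong (H2 a +_) (sym (H2-suc b))) ⟩
    H2 a + H2 (suc b)                      ≈⟨ H2-sum a (suc b) (trans (ℕP.+-suc a b) a+b≡T) ⟩
    H2 T                                   ∎
    where open ≈-Reasoning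

  T-even : ∃ λ h → T ≡ h ℕ.+ h
  T-even with 2∣n⊎2∣1+n T
  ... | inj₁ (divides h T≡h*2) = h , trans T≡h*2 (m*2≡m+m h)
  ... | inj₂ 2∣1+T with prime⇒irreducible p-prime (subst (2 ∣_) 1+T≡p 2∣1+T)
  ...   | inj₁ ()
  ...   | inj₂ 2≡p = ⊥-elim (ℕP.<-asym (subst (3 ℕ.<_) (sym 2≡p) 3<p) (ℕP.n<1+n 2))

  -- With T = 2h, j ↦ p - j swaps the odd- and even-denominator halves of H2 T, and 4 × (even half) = H2 h;
  -- so H2-sum h h gives 6 × (even half) ≡ 0.
  H2[T]≈0 : H2 T ≈ 0ℚ
  H2[T]≈0 with T-even
  ... | h , T≡h+h = ≈-trans H2[T]≈even+even (+-cong even≈0 even≈0)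
    where
    u : ℕ → ℚ
    u j = 1/suc j * 1/suc j
    odd even : ℚ
    odd  = sumBelow h (λ i → u (i ℕ.+ i))
    even = sumBelow h (λ i → u (suc (i ℕ.+ i)))

    H2≡sumBelow : ∀ k → H2 k ≡ sumBelow k u
    H2≡sumBelow zero    = refl
    H2≡sumBelow (suc k) = trans (H2-suc k) (cong (_+ u k) (H2≡sumBelow k))

    odd≈even : odd ≈ even
    odd≈even = ≈-trans (sumBelow-cong-≈ h (λ i i<h → 1/suc²≈1/suc² (i ℕ.+ i) (suc (j i ℕ.+ j i)) (paired i i<h)))
                       (≈-reflexive (sumBelow-reverse h (λ i → u (suc (i ℕ.+ i)))))
      where
      j : ℕ → ℕ
      j i = h ∸ suc i
      shape : ∀ i j → suc (i ℕ.+ i) ℕ.+ suc (suc (j ℕ.+ j)) ≡ suc ((suc i ℕ.+ j) ℕ.+ (suc i ℕ.+ j))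
      shape = solve-∀
      paired : ∀ i → i ℕ.< h → suc (i ℕ.+ i) ℕ.+ suc (suc (j i ℕ.+ j i)) ≡ p
      paired i i<h = begin
        suc (i ℕ.+ i) ℕ.+ suc (suc (j i ℕ.+ j i))       ≡⟨ shape i (j i) ⟩
        suc ((suc i ℕ.+ j i) ℕ.+ (suc i ℕ.+ j i))       ≡⟨ cong (λ x → suc (x ℕ.+ x)) (ℕP.m+[n∸m]≡n i<h) ⟩
        suc (h ℕ.+ h)                                   ≡⟨ cong suc (sym T≡h+h) ⟩
        suc T                                           ≡⟨ 1+T≡p ⟩
        p                                               ∎
        where open ≡-Reasoning

    H2[h]≡4*even : H2 h ≡ ι 4 * even
    H2[h]≡4*even = begin
      H2 h                                            ≡⟨ H2≡sumBelow h ⟩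
      sumBelow h u                                    ≡⟨ sumBelow-cong h (λ i _ → sym (quarter i)) ⟩
      sumBelow h (λ i → ι 4 * u (suc (i ℕ.+ i)))      ≡⟨ sym (*-sumBelow (ι 4) h _) ⟩
      ι 4 * even                                      ∎
      where
      open ≡-Reasoning
      quarter : ∀ i → ι 4 * u (suc (i ℕ.+ i)) ≡ u i
      quarter i = trans (solve 1 (λ v → con (ι 4) :* (v :* v) := (con (ι 2) :* v) :* (con (ι 2) :* v)) refl (1/suc (suc (i ℕ.+ i))))
                        (cong₂ _*_ (ι2*1/suc[1+i+i]≡1/suc i) (ι2*1/suc[1+i+i]≡1/suc i))

    H2[T]≈even+even : H2 T ≈ even + even
    H2[T]≈even+even = begin
      H2 T             ≡⟨ trans (cong H2 T≡h+h) (H2≡sumBelow (h ℕ.+ h)) ⟩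
      sumBelow (h ℕ.+ h) u ≡⟨ sumBelow-even+odd h u ⟩
      odd + even       ≈⟨ +-cong odd≈even (≈-refl {even}) ⟩
      even + even      ∎
      where open ≈-Reasoning

    even≈0 : even ≈ 0ℚ
    even≈0 = *-cancelˡ-≈ {6} p∤6 (begin
      ι 6 * even                                        ≡⟨ solve 1 (λ e → con (ι 6) :* e := (con (ι 4) :* e :+ con (ι 4) :* e) :- (e :+ e)) refl even ⟩
      (ι 4 * even + ι 4 * even) - (even + even)         ≡⟨ cong (λ x → (x + x) - (even + even)) (sym H2[h]≡4*even) ⟩
      (H2 h + H2 h) - (even + even)                     ≈⟨ +-cong (≈-trans (H2-sum h h (sym T≡h+h)) H2[T]≈even+even) (≈-refl { - (even + even)}) ⟩
      (even + even) - (even + even)                     ≡⟨ solve 1 (λ e → (e :+ e) :- (e :+ e) := con (ι 6) :* con 0ℚ) refl even ⟩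
      ι 6 * 0ℚ                                          ∎)
      where open ≈-Reasoning

  H2-reflect : ∀ a b → a ℕ.+ b ≡ T → H2 a ≈ - H2 b
  H2-reflect a b a+b≡T = begin
    H2 a                    ≡⟨ solve 2 (λ x y → x := (x :+ y) :- y) refl (H2 a) (H2 b) ⟩
    (H2 a + H2 b) - H2 b    ≈⟨ +-cong (≈-trans (H2-sum a b a+b≡T) H2[T]≈0) (≈-refl { - H2 b}) ⟩
    0ℚ - H2 b               ≡⟨ ℚP.+-identityˡ (- H2 b) ⟩
    - H2 b                  ∎
    where open ≈-Reasoning

  H-integral : ∀ k → k ℕ.< p → Integral (H k)
  H-integral zero    _   = integral-ι 0
  H-integral (suc k) k<p = integral-+ (H-integral k (ℕP.<-trans (ℕP.n<1+n k) k<p)) (integral-1/suc (p∤suc k<p))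

  H2-integral : ∀ k → k ℕ.< p → Integral (H2 k)
  H2-integral zero    _   = integral-ι 0
  H2-integral (suc k) k<p = subst Integral (sym (H2-suc k))
    (integral-+ (H2-integral k (ℕP.<-trans (ℕP.n<1+n k) k<p)) (integral-* i1/suc i1/suc))
    where
    i1/suc : Integral (1/suc k)
    i1/suc = integral-1/suc (p∤suc k<p)

  -- Below 2p the only denominator divisible by p is p itself.
  p*1/suc-integral : ∀ j → suc j ℕ.< p ℕ.+ p → Integral (ι p * 1/suc j)
  p*1/suc-integral j 1+j<2p with suc j ℕP.≟ p
  ... | yes 1+j≡p = subst Integral (sym (trans (cong (λ q → ι q * 1/suc j) (sym 1+j≡p)) (ι[1+k]*1/suc≡1 j))) (integral-ι 1)
  ... | no  1+j≢p = integral-* (integral-ι p) (integral-1/suc p∤1+j)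
    where
    p∤1+j : ¬ p ∣ suc j
    p∤1+j (divides zero ())
    p∤1+j (divides (suc zero) 1+j≡p+0) = 1+j≢p (trans 1+j≡p+0 (ℕP.+-identityʳ p))
    p∤1+j (divides (suc (suc q)) 1+j≡[2+q]p) =
      ℕP.<-irrefl refl (ℕP.<-≤-trans 1+j<2p (subst (p ℕ.+ p ℕ.≤_) (sym 1+j≡[2+q]p) (ℕP.+-monoʳ-≤ p (ℕP.m≤m+n p (q ℕ.* p)))))

  p*H-integral : ∀ k → k ℕ.< p ℕ.+ p → Integral (ι p * H k)
  p*H-integral zero    _    = subst Integral (sym (ℚP.*-zeroʳ (ι p))) (integral-ι 0)
  p*H-integral (suc k) k<2p = subst Integral (sym (ℚP.*-distribˡ-+ (ι p) (H k) (1/suc k)))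
    (integral-+ (p*H-integral k (ℕP.<-trans (ℕP.n<1+n k) k<2p)) (p*1/suc-integral k k<2p))

  p*p*H2-integral : ∀ k → k ℕ.< p ℕ.+ p → Integral (ι p * (ι p * H2 k))
  p*p*H2-integral zero    _    = subst Integral (sym (trans (cong (ι p *_) (ℚP.*-zeroʳ (ι p))) (ℚP.*-zeroʳ (ι p)))) (integral-ι 0)
  p*p*H2-integral (suc k) k<2p = subst Integral (sym expand)
    (integral-+ (p*p*H2-integral k (ℕP.<-trans (ℕP.n<1+n k) k<2p)) (integral-* p/[1+k] p/[1+k]))
    where
    p/[1+k] : Integral (ι p * 1/suc k)
    p/[1+k] = p*1/suc-integral k k<2p
    expand : ι p * (ι p * H2 (suc k)) ≡ ι p * (ι p * H2 k) + (ι p * 1/suc k) * (ι p * 1/suc k)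
    expand = trans (cong (λ h → ι p * (ι p * h)) (H2-suc k))
      (solve 3 (λ P h r → P :* (P :* (h :+ r :* r)) := P :* (P :* h) :+ (P :* r) :* (P :* r)) refl (ι p) (H2 k) (1/suc k))

  summand<p : ∀ {a b} → a ℕ.+ b ≡ T → a ℕ.< p
  summand<p {a} {b} a+b≡T = ℕP.≤-<-trans (subst (a ℕ.≤_) a+b≡T (ℕP.m≤m+n a b)) (subst (T ℕ.<_) 1+T≡p ℕP.≤-refl)

  H²-reflect : ∀ a b → a ℕ.+ b ≡ T → pow (H a) 2 ≈ pow (H b) 2
  H²-reflect a b a+b≡T = pow-cong 2 (H-integral a (summand<p a+b≡T)) (H-integral b (summand<p (trans (ℕP.+-comm b a) a+b≡T)))
    (H-reflect a b a+b≡T)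

  p*p*H-integral : ∀ k → k ℕ.< p ℕ.+ p → Integral (ι p * (ι p * H k))
  p*p*H-integral k k<2p = integral-* (integral-ι p) (p*H-integral k k<2p)

  p*p*H²-integral : ∀ k → k ℕ.< p ℕ.+ p → Integral (ι p * (ι p * pow (H k) 2))
  p*p*H²-integral k k<2p = subst Integral (solve 2 (λ P h → (P :* h) :* ((P :* h) :* con 1ℚ) := P :* (P :* (h :* (h :* con 1ℚ)))) refl (ι p) (H k))
    (integral-pow 2 (p*H-integral k k<2p))

module BinomialReflection (p : ℕ) (p-prime : Prime p) (m N : ℕ) (1+N+m≡p : suc (N ℕ.+ m) ≡ p) where

  open import Data.Nat using (zero; _!; _≤_; s≤s)
  import Data.Nat.Properties as ℕP
  open import Data.Nat.Divisibility using (_∣_; divides; ∣-trans; m∣m*n; m≤n⇒m!∣n!)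
  open import Data.Nat.Primality using (euclidsLemma)
  open import Data.Nat.Combinatorics using (_C_; nCn≡1)
  open import Data.Rational using (ℚ; 0ℚ; 1ℚ; _+_; _*_; -_)
  import Data.Rational.Properties as ℚP
  open import Data.Sum using (_⊎_; inj₁; inj₂)
  open import Data.Empty using (⊥-elim)
  open import Relation.Nullary using (¬_)
  open import Relation.Binary.PropositionalEquality
  open import Data.Rational.Solver using (module +-*-Solver)
  open +-*-Solver
  open import Data.Nat.Tactic.RingSolver using (solve-∀)
  open ℕ-Facts
  open Embedding
  open Powers
  open Congruence p p-prime

  N<p : N < p
  N<p = subst (N <_) 1+N+m≡p (s≤s (ℕP.m≤m+n N m))

  m<p : m < p
  m<p = subst (m <_) 1+N+m≡p (s≤s (ℕP.m≤n+m m N))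

  B : ℕ → ℚ
  B k = ι ((m ℕ.+ k) C m)

  p∤! : ∀ j → j < p → ¬ p ∣ j !
  p∤! zero    _     = p∤1
  p∤! (suc j) 1+j<p = p∤* {suc j} {j !} (p∤suc 1+j<p) (p∤! j (ℕP.<-trans (ℕP.n<1+n j) 1+j<p))

  p∣! : ∀ {j} → p ≤ j → p ∣ j !
  p∣! p≤j = ∣-trans (subst (λ q → q ∣ q !) 1+N+m≡p (m∣m*n ((N ℕ.+ m) !))) (m≤n⇒m!∣n! p≤j)

  p∤C : ∀ k → m ℕ.+ k < p → ¬ p ∣ (m ℕ.+ k) C m
  p∤C k m+k<p p∣C =
    p∤! (m ℕ.+ k) m+k<p (subst (p ∣_) ([m+k]Cm*[m!*k!]≡[m+k]! m k) (∣-trans p∣C (m∣m*n (m ! ℕ.* k !))))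

  p∣C : ∀ k → k < p → p ≤ m ℕ.+ k → p ∣ (m ℕ.+ k) C m
  p∣C k k<p p≤m+k with euclidsLemma ((m ℕ.+ k) C m) (m ! ℕ.* k !) p-prime
                         (subst (p ∣_) (sym ([m+k]Cm*[m!*k!]≡[m+k]! m k)) (p∣! p≤m+k))
  ... | inj₁ p∣[m+k]Cm = p∣[m+k]Cm
  ... | inj₂ p∣m!k!    = ⊥-elim (p∤* (p∤! m m<p) (p∤! k k<p) p∣m!k!)

  B-integral : ∀ k → Integral (B k)
  B-integral k = integral-ι ((m ℕ.+ k) C m)

  B[0]≡1 : B 0 ≡ 1ℚ
  B[0]≡1 = cong ι (trans (cong (_C m) (ℕP.+-identityʳ m)) (nCn≡1 m))

  B-suc : ∀ k → ι (suc k) * B (suc k) ≡ ι (m ℕ.+ suc k) * B k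
  B-suc k = trans (sym (ι-* (suc k) ((m ℕ.+ suc k) C m)))
    (trans (cong ι ([1+k]*[m+1+k]Cm≡[m+1+k]*[m+k]Cm m k)) (ι-* (m ℕ.+ suc k) ((m ℕ.+ k) C m)))

  ι≈-ι : ∀ x y → x ℕ.+ y ≡ p → ι x ≈ - ι y
  ι≈-ι x y x+y≡p = +≈0⇒≈- (≈-trans (≈-reflexive (trans (sym (ι-+ x y)) (cong ι x+y≡p))) ι[p]≈0)

  private
    1+a+[m+1+b]≡p : ∀ a b → suc (a ℕ.+ b) ≡ N → suc a ℕ.+ (m ℕ.+ suc b) ≡ p
    1+a+[m+1+b]≡p a b 1+a+b≡N = trans (shape a b m) (trans (cong (λ x → suc (x ℕ.+ m)) 1+a+b≡N) 1+N+m≡p)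
      where
      shape : ∀ a b m → suc a ℕ.+ (m ℕ.+ suc b) ≡ suc (suc (a ℕ.+ b) ℕ.+ m)
      shape = solve-∀

  -- Modulo p, the recursion B-suc read backwards in j is the recursion forwards in k.
  B-reflect : ∀ k j → k ℕ.+ j ≡ N → B N * B k ≈ B j
  B-reflect zero    j refl = ≈-reflexive (trans (cong (B j *_) B[0]≡1) (ℚP.*-identityʳ (B j)))
  B-reflect (suc k) j 1+k+j≡N = ≈-sym (*-cancelˡ-≈ {suc k} p∤1+k (begin
    ι (suc k) * B j                    ≈⟨ *-cong (integral-ι (suc k)) (B-integral j) 1+k≈-[m+1+j] (≈-refl {B j}) ⟩
    - ι (m ℕ.+ suc j) * B j            ≡⟨ sym (ℚP.neg-distribˡ-* (ι (m ℕ.+ suc j)) (B j)) ⟩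
    - (ι (m ℕ.+ suc j) * B j)          ≡⟨ cong -_ (sym (B-suc j)) ⟩
    - (ι (suc j) * B (suc j))          ≈⟨ neg-cong (*-cong (integral-ι (suc j)) (B-integral (suc j)) 1+j≈-[m+1+k] (≈-refl {B (suc j)})) ⟩
    - (- ι (m ℕ.+ suc k) * B (suc j))  ≡⟨ solve 2 (λ x y → :- (:- x :* y) := x :* y) refl (ι (m ℕ.+ suc k)) (B (suc j)) ⟩
    ι (m ℕ.+ suc k) * B (suc j)        ≈⟨ *-cong (integral-ι (m ℕ.+ suc k)) (integral-* (B-integral N) (B-integral k))
                                               (≈-refl {ι (m ℕ.+ suc k)}) (≈-sym induction-hypothesis) ⟩
    ι (m ℕ.+ suc k) * (B N * B k)      ≡⟨ solve 3 (λ x y z → x :* (y :* z) := y :* (x :* z)) refl (ι (m ℕ.+ suc k)) (B N) (B k) ⟩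
    B N * (ι (m ℕ.+ suc k) * B k)      ≡⟨ cong (B N *_) (sym (B-suc k)) ⟩
    B N * (ι (suc k) * B (suc k))      ≡⟨ solve 3 (λ x y z → x :* (y :* z) := y :* (x :* z)) refl (B N) (ι (suc k)) (B (suc k)) ⟩
    ι (suc k) * (B N * B (suc k))      ∎))
    where
    open ≈-Reasoning
    p∤1+k : ¬ p ∣ suc k
    p∤1+k = p∤suc (ℕP.≤-<-trans (subst (suc k ≤_) 1+k+j≡N (ℕP.m≤m+n (suc k) j)) N<p)
    1+k≈-[m+1+j] : ι (suc k) ≈ - ι (m ℕ.+ suc j)
    1+k≈-[m+1+j] = ι≈-ι (suc k) (m ℕ.+ suc j) (1+a+[m+1+b]≡p k j 1+k+j≡N)
    1+j≈-[m+1+k] : ι (suc j) ≈ - ι (m ℕ.+ suc k)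
    1+j≈-[m+1+k] = ι≈-ι (suc j) (m ℕ.+ suc k) (1+a+[m+1+b]≡p j k (trans (cong suc (ℕP.+-comm j k)) 1+k+j≡N))
    induction-hypothesis : B N * B k ≈ B (suc j)
    induction-hypothesis = B-reflect k (suc j) (trans (ℕP.+-suc k j) 1+k+j≡N)

  B[N]^n≈1 : ∀ n → 2 ∣ n ⊎ 2 ∣ N → pow (B N) n ≈ 1ℚ
  B[N]^n≈1 n (inj₁ (divides q n≡q*2)) = begin
    pow (B N) n            ≡⟨ trans (cong (pow (B N)) n≡q*2) (pow-*-pow (B N) 2 q) ⟩
    pow (pow (B N) 2) q    ≈⟨ pow-cong q (integral-pow 2 (B-integral N)) (integral-ι 1) B[N]²≈1 ⟩
    pow 1ℚ q               ≡⟨ pow-1ℚ q ⟩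
    1ℚ                     ∎
    where
    open ≈-Reasoning
    B[N]²≈1 : pow (B N) 2 ≈ 1ℚ
    B[N]²≈1 = ≈-trans (≈-reflexive (cong (B N *_) (ℚP.*-identityʳ (B N))))
                      (≈-trans (B-reflect N 0 (ℕP.+-identityʳ N)) (≈-reflexive B[0]≡1))
  B[N]^n≈1 n (inj₂ (divides h N≡h*2)) = ≈-trans (pow-cong n (B-integral N) (integral-ι 1) B[N]≈1) (≈-reflexive (pow-1ℚ n))
    where
    h+h≡N : h ℕ.+ h ≡ N
    h+h≡N = sym (trans N≡h*2 (m*2≡m+m h))
    m+h<p : m ℕ.+ h < p
    m+h<p = subst (m ℕ.+ h <_) 1+N+m≡p (s≤s (subst (m ℕ.+ h ≤_) (ℕP.+-comm m N) (ℕP.+-monoʳ-≤ m (subst (h ≤_) h+h≡N (ℕP.m≤m+n h h)))))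
    B[N]≈1 : B N ≈ 1ℚ
    B[N]≈1 = *-cancelˡ-≈ {(m ℕ.+ h) C m} (p∤C h m+h<p) (begin
      B h * B N    ≡⟨ ℚP.*-comm (B h) (B N) ⟩
      B N * B h    ≈⟨ B-reflect h h h+h≡N ⟩
      B h          ≡⟨ sym (ℚP.*-identityʳ (B h)) ⟩
      B h * 1ℚ     ∎)
      where open ≈-Reasoning

  coef-reflect : ∀ {n} → 2 ∣ n ⊎ 2 ∣ N → ∀ k j → k ℕ.+ j ≡ N → coef n m k ≈ coef n m j
  coef-reflect {n} parity k j k+j≡N = begin
    pow (B k) n                  ≡⟨ sym (ℚP.*-identityˡ (pow (B k) n)) ⟩
    1ℚ * pow (B k) n             ≈⟨ *-cong (integral-ι 1) (integral-pow n (B-integral k)) (≈-sym (B[N]^n≈1 n parity)) (≈-refl {pow (B k) n}) ⟩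
    pow (B N) n * pow (B k) n    ≡⟨ sym (pow-distribʳ-* (B N) (B k) n) ⟩
    pow (B N * B k) n            ≈⟨ pow-cong n (integral-* (B-integral N) (B-integral k)) (B-integral j) (B-reflect k j k+j≡N) ⟩
    pow (B j) n                  ∎
    where open ≈-Reasoning

  N<k⇒p≤m+k : ∀ {k} → N < k → p ≤ m ℕ.+ k
  N<k⇒p≤m+k {k} N<k = subst (_≤ m ℕ.+ k) 1+N+m≡p (subst (suc (N ℕ.+ m) ≤_) (ℕP.+-comm k m) (ℕP.+-monoˡ-≤ m N<k))

  coef-tail≈0 : ∀ {n} → 3 ≤ n → ∀ k → N < k → k < p → ∀ x → Integral (ι p * (ι p * x)) → coef n m k * x ≈ 0ℚ
  coef-tail≈0 {n@(suc (suc (suc n'')))} (s≤s (s≤s (s≤s _))) k N<k k<p x p²x-integral with p∣C k k<p (N<k⇒p≤m+k N<k)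
  ... | divides q C≡q*p = ≈-trans (≈-reflexive coef*x≡p*w)
    (p*≈0 (integral-* (integral-* (integral-pow n (integral-ι q)) (integral-pow n'' (integral-ι p))) p²x-integral))
    where
    open ≡-Reasoning
    coef*x≡p*w : coef n m k * x ≡ ι p * ((pow (ι q) n * pow (ι p) n'') * (ι p * (ι p * x)))
    coef*x≡p*w = begin
      pow (B k) n * x                   ≡⟨ cong (λ c → pow c n * x) (trans (cong ι C≡q*p) (ι-* q p)) ⟩
      pow (ι q * ι p) n * x             ≡⟨ cong (_* x) (pow-distribʳ-* (ι q) (ι p) n) ⟩
      pow (ι q) n * pow (ι p) n * x
        ≡⟨ solve 4 (λ Q P R x → Q :* (P :* (P :* (P :* R))) :* x := P :* ((Q :* R) :* (P :* (P :* x))))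
                   refl (pow (ι q) n) (ι p) (pow (ι p) n'') x ⟩
      ι p * ((pow (ι q) n * pow (ι p) n'') * (ι p * (ι p * x))) ∎

  weighted-sum-reflect : ∀ {n} → 3 ≤ n → 2 ∣ n ⊎ 2 ∣ N → (F G : ℕ → ℚ) →
    (∀ k → k < p → Integral (F k)) → (∀ k → k < p → Integral (ι p * (ι p * G k))) →
    (∀ k j → k ℕ.+ j ≡ N → G k ≈ F j) →
    sumBelow p (λ k → coef n m k * F k) ≈ sumBelow p (λ k → coef n m k * G k)
  weighted-sum-reflect {n} 3≤n parity F G F-integral p²G-integral G≈F =
    subst (λ q → sumBelow q (λ k → coef n m k * F k) ≈ sumBelow q (λ k → coef n m k * G k)) 1+N+m≡p
      (sumBelow-reflect-≈ N m reflected (tail F p²F-integral) (tail G p²G-integral))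
    where
    p²F-integral : ∀ k → k < p → Integral (ι p * (ι p * F k))
    p²F-integral k k<p = integral-* (integral-ι p) (integral-* (integral-ι p) (F-integral k k<p))
    reflected : ∀ k j → k ℕ.+ j ≡ N → coef n m k * G k ≈ coef n m j * F j
    reflected k j k+j≡N = *-cong (integral-pow n (B-integral k)) (F-integral j j<p) (coef-reflect parity k j k+j≡N) (G≈F k j k+j≡N)
      where
      j<p : j < p
      j<p = ℕP.≤-<-trans (subst (j ≤_) k+j≡N (ℕP.m≤n+m j k)) N<p
    tail : ∀ Φ → (∀ k → k < p → Integral (ι p * (ι p * Φ k))) → ∀ i → i < m → coef n m (suc N ℕ.+ i) * Φ (suc N ℕ.+ i) ≈ 0ℚ
    tail Φ p²Φ-integral i i<m = coef-tail≈0 3≤n (suc N ℕ.+ i) (s≤s (ℕP.m≤m+n N i)) k<p (Φ (suc N ℕ.+ i)) (p²Φ-integral _ k<p)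
      where
      k<p : suc N ℕ.+ i < p
      k<p = subst (suc N ℕ.+ i <_) 1+N+m≡p (ℕP.+-monoʳ-< (suc N) i<m)

open import Data.Nat using (_≤_; _+_; _*_; s≤s; z≤n)
open import Data.Rational using (ℚ; -_)
open import Data.Product using (_×_; _,_)
open import Relation.Binary.PropositionalEquality using (sym; trans; cong)
open import Data.Nat.Divisibility using (_∣_)
open import Data.Sum using (_⊎_)
open import Data.Nat.Tactic.RingSolver using (solve-∀)
import Data.Nat.Properties as ℕP
open ℕ-Facts using (2∣1+n⊎2∣m*n)
open FiniteSums using (sumBelow-*-negate)

lemma2p4 : (n p m : ℕ) → 3 ≤ n → Prime p → 3 < p → p ≡ 1 + m * n →
    (sumBelow p (λ k → coef n m k Data.Rational.* H k)
    ≡ sumBelow p (λ k → coef n m k Data.Rational.* H (k + m)) [modℚ p ])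
    × (sumBelow p (λ k → coef n m k Data.Rational.* pow (H k) 2)
    ≡ sumBelow p (λ k → coef n m k Data.Rational.* pow (H (k + m)) 2) [modℚ p ])
    × (sumBelow p (λ k → coef n m k Data.Rational.* H2 k)
    ≡ - sumBelow p (λ k → coef n m k Data.Rational.* H2 (k + m)) [modℚ p ])
lemma2p4 n@(suc (suc (suc n'))) p m 3≤n@(s≤s (s≤s (s≤s z≤n))) p-prime 3<p p≡1+mn =
  ≈⇒≡[modℚ] (weighted-sum-reflect 3≤n parity H (λ k → H (k + m))
               H-integral (shifted p*p*H-integral) (shift H-reflect)) ,
  ≈⇒≡[modℚ] (weighted-sum-reflect 3≤n parity (λ k → pow (H k) 2) (λ k → pow (H (k + m)) 2)
               (λ k k<p → integral-pow 2 (H-integral k k<p)) (shifted p*p*H²-integral) (shift H²-reflect)) ,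
  ≈⇒≡[modℚ] (≈-trans (≈-reflexive (sumBelow-*-negate p (coef n m) H2))
               (neg-cong (weighted-sum-reflect 3≤n parity (λ k → - H2 k) (λ k → H2 (k + m))
                           (λ k k<p → integral-neg (H2-integral k k<p)) (shifted p*p*H2-integral) (shift H2-reflect))))
  where
  N : ℕ
  N = m * suc (suc n')
  1+N+m≡p : suc (N + m) ≡ p
  1+N+m≡p = trans (shape m n') (sym p≡1+mn)
    where
    shape : ∀ m n' → suc (m * suc (suc n') + m) ≡ 1 + m * suc (suc (suc n'))
    shape = solve-∀
  parity : 2 ∣ n ⊎ 2 ∣ N
  parity = 2∣1+n⊎2∣m*n m (suc (suc n'))
  open Congruence p p-prime
  open HarmonicReflection p p-prime 3<p 1+N+m≡p
  open BinomialReflection p p-prime m N 1+N+m≡p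
  shift : ∀ {R : ℕ → ℕ → Set} → (∀ a b → a + b ≡ N + m → R a b) → ∀ k j → k + j ≡ N → R (k + m) j
  shift R-reflect k j k+j≡N =
    R-reflect (k + m) j (trans (ℕP.+-assoc k m j)
      (trans (cong (k +_) (ℕP.+-comm m j)) (trans (sym (ℕP.+-assoc k j m)) (cong (_+ m) k+j≡N))))
  shifted : ∀ {P : ℕ → Set} → (∀ k → k < p + p → P k) → ∀ k → k < p → P (k + m)
  shifted P<2p k k<p = P<2p (k + m) (ℕP.+-mono-<-≤ k<p (ℕP.<⇒≤ m<p))
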